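{- Let $r\geq 2$ be an integer and let $G$ be a finite simple graph of order $n$ with no isolated vertices that contains no complete graph $K_{r+1}$ as a subgraph. If $c=\lceil(\delta(G)+1)/2\rceil$, then $$\gamma_{st}(G)\geq \frac{r}{r-1}\left(-(c-1)+\sqrt{(c-1)^2+4\,\frac{r-1}{r}\,c\,n}\right)-n.$$
   Context: $\delta(G)$ is the minimum degree of $G$. A signed total dominating function (STDF) of $G=(V,E)$ is a function $f:V\to\{ -1,1\}$ with $\sum_{u\in N(v)}f(u)\geq 1$ for every $v\in V$, where $N(v)$ is the open neighborhood of $v$; the signed total domination number $\gamma_{st}(G)$ is the minimum of $\sum_{v\in V}f(v)$ over all STDFs $f$. -}

module Defs where

open import Data.Bool using (Bool; true; false; if_then_else_)
open import Data.Nat as ℕ using (ℕ; zero; suc)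
open import Data.Nat.DivMod using (_/_)
open import Data.Fin using (Fin)
open import Data.List using (List; map; foldr; allFin)
open import Data.Integer as ℤ using (ℤ; +_)
open import Data.Rational as ℚ using (ℚ)
open import Data.Product using (Σ; ∃; _×_)
open import Data.Sum using (_⊎_)
open import Function.Definitions using (Injective)
open import Relation.Binary.PropositionalEquality using (_≡_; _≢_)

record SimpleGraph (n : ℕ) : Set where
  field
    adj    : Fin n → Fin n → Bool
    sym    : ∀ u v → adj u v ≡ adj v u
    irrefl : ∀ v → adj v v ≡ false
open SimpleGraph public

sumℕ : ∀ {n} → (Fin n → ℕ) → ℕ
sumℕ {n} g = foldr ℕ._+_ 0 (map g (allFin n))

sumℤ : ∀ {n} → (Fin n → ℤ) → ℤ
sumℤ {n} g = foldr ℤ._+_ (+ 0) (map g (allFin n))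

degree : ∀ {n} → SimpleGraph n → Fin n → ℕ
degree G v = sumℕ (λ u → if adj G v u then 1 else 0)

NoIsolatedVertices : ∀ {n} → SimpleGraph n → Set
NoIsolatedVertices G = ∀ v → degree G v ≢ 0

IsMinDegree : ∀ {n} → SimpleGraph n → ℕ → Set
IsMinDegree G d = (∃ λ v → degree G v ≡ d) × (∀ v → d ℕ.≤ degree G v)

ContainsComplete : ∀ {n} → SimpleGraph n → ℕ → Set
ContainsComplete {n} G m =
  Σ (Fin m → Fin n) λ φ → Injective _≡_ _≡_ φ × (∀ i j → i ≢ j → adj G (φ i) (φ j) ≡ true)

nbhdSum : ∀ {n} → SimpleGraph n → (Fin n → ℤ) → Fin n → ℤ
nbhdSum G f v = sumℤ (λ u → if adj G v u then f u else + 0)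

weight : ∀ {n} → (Fin n → ℤ) → ℤ
weight f = sumℤ f

IsSTDF : ∀ {n} → SimpleGraph n → (Fin n → ℤ) → Set
IsSTDF G f = (∀ v → f v ≡ ℤ.1ℤ ⊎ f v ≡ ℤ.-1ℤ) × (∀ v → ℤ.1ℤ ℤ.≤ nbhdSum G f v)

IsSignedTotalDomNumber : ∀ {n} → SimpleGraph n → ℤ → Set
IsSignedTotalDomNumber G γ =
  (∃ λ f → IsSTDF G f × weight f ≡ γ) × (∀ f → IsSTDF G f → γ ℤ.≤ weight f)

-- c = ⌈(δ+1)/2⌉ = ⌊(δ+2)/2⌋
ceilHalfSucc : ℕ → ℕ
ceilHalfSucc d = (d ℕ.+ 2) / 2

frac : ℤ → (d : ℕ) → 1 ℕ.≤ d → ℚ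
frac p (suc d) _ = p ℚ./ suc d

ofℕ : ℕ → ℚ
ofℕ m = frac (+ m) 1 (ℕ.s≤s ℕ.z≤n)

module Submission where

-- Let f be a signed total dominating function of G with weight γ, let P and M be the
-- vertices where f is +1 and -1, and p = |P|, m = |M|; so n = p + m and γ = p - m.
-- Total domination gives every vertex more neighbours in P than in M, hence at least
-- c = ⌈(δ+1)/2⌉ neighbours in P. Counting ordered pairs of adjacent vertices,
--     m·c + p  ≤  e(M,P) + p  =  e(P,M) + p  ≤  e(P,P),
-- and Turán's theorem, in the form (k+1)·e(S,S) ≤ k·|S|² for sets S without a clique of
-- size k + 2, gives r·e(P,P) ≤ (r-1)·p² because G has no K_{r+1}. Thus
-- r·(m·c + p) ≤ (r-1)·p², a quadratic inequality for p which, solved over ℚ by comparing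
-- squares, is the stated lower bound for γ = 2p - n.

open import Defs hiding (sym)
open import Data.Nat as ℕ using (ℕ; _∸_; suc; z≤n; s≤s)
open import Data.Nat.Properties using (≤-trans; ∸-monoˡ-≤)
import Data.Nat.Properties as ℕP
open import Data.Integer as ℤ using (ℤ; +_)
import Data.Integer.Properties as ℤP
open import Data.Rational as ℚ using (ℚ; 0ℚ)
open import Data.Product using (Σ; ∃; _×_; _,_; proj₁; proj₂)
open import Relation.Nullary using (¬_)
open import Relation.Binary.PropositionalEquality

module Counting where
  open import Data.Nat using (zero; _+_; _*_; _≤_)
  open import Data.Bool using (Bool; true; false; _∧_; not; if_then_else_)
  open import Data.Fin using (Fin; zero; suc)
  open import Data.List using (foldr; map; tabulate; allFin)
  open import Data.List.Properties using (map-tabulate)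
  import Data.Vec.Functional as Vector
  open import Data.Vec.Functional using (_∷_)
  open import Function using (id; _∘_)
  open import Function.Definitions using (Injective)
  open import Data.Empty using (⊥-elim)
  open import Data.Sum using (_⊎_; inj₁; inj₂)
  import Data.List.Relation.Unary.All as All
  open import Data.List.Membership.Propositional.Properties using (∈-allFin)
  open import Data.List.Extrema ℕP.≤-totalOrder using (argmax; f[xs]≤f[argmax])
  open import Data.Nat.DivMod using (m<n*o⇒m/o<n; m≥n⇒m/n>0)
  open import Algebra.Properties.CommutativeSemigroup ℕP.*-commutativeSemigroup using (x∙yz≈y∙xz)
  open import Algebra.Properties.Semiring.Sum ℕP.+-*-semiring
    using (sum; ∑-distrib-+; ∑-comm; sum-cong-≗; *-distribˡ-sum; *-distribʳ-sum; sum-replicate-zero)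
  open import Data.Nat.Solver using () renaming (module +-*-Solver to NatSolver)
  open import Data.Integer.Solver using () renaming (module +-*-Solver to IntSolver)

  -- The vertex sums of Defs fold over the list allFin n; they agree with the
  -- library's finite sums over Fin n, for which summation algebra is available.
  foldr-tabulate : ∀ {A : Set} (_∙_ : A → A → A) (ε : A) {n} (g : Fin n → A) →
    foldr _∙_ ε (tabulate g) ≡ Vector.foldr _∙_ ε g
  foldr-tabulate _∙_ ε {zero}  g = refl
  foldr-tabulate _∙_ ε {suc n} g = cong (g zero ∙_) (foldr-tabulate _∙_ ε (g ∘ suc))

  foldr-allFin : ∀ {A : Set} (_∙_ : A → A → A) (ε : A) {n} (g : Fin n → A) →
    foldr _∙_ ε (map g (allFin n)) ≡ Vector.foldr _∙_ ε g
  foldr-allFin _∙_ ε g = trans (cong (foldr _∙_ ε) (map-tabulate id g)) (foldr-tabulate _∙_ ε g)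

  sumℕ≡sum : ∀ {n} (g : Fin n → ℕ) → sumℕ g ≡ sum g
  sumℕ≡sum = foldr-allFin _+_ 0

  sumℤ-difference : ∀ {n} (g : Fin n → ℤ) (a b : Fin n → ℕ) →
    (∀ u → g u ≡ + a u ℤ.- + b u) → sumℤ g ≡ + sum a ℤ.- + sum b
  sumℤ-difference g a b g≡a-b = trans (foldr-allFin ℤ._+_ (+ 0) g) (vector-difference g a b g≡a-b)
    where
    open IntSolver
    vector-difference : ∀ {n} (g : Fin n → ℤ) (a b : Fin n → ℕ) → (∀ u → g u ≡ + a u ℤ.- + b u) →
         Vector.foldr ℤ._+_ (+ 0) g ≡ + sum a ℤ.- + sum b
    vector-difference {zero}  g a b _      = refl
    vector-difference {suc n} g a b g≡a-b = begin
      g zero ℤ.+ Vector.foldr ℤ._+_ (+ 0) (g ∘ suc)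
        ≡⟨ cong₂ ℤ._+_ (g≡a-b zero) (vector-difference (g ∘ suc) (a ∘ suc) (b ∘ suc) (g≡a-b ∘ suc)) ⟩
      (+ a zero ℤ.- + b zero) ℤ.+ (+ A ℤ.- + B)
        ≡⟨ solve 4 (λ x y z w → (x :- y) :+ (z :- w) := (x :+ z) :- (y :+ w)) refl
                 (+ a zero) (+ b zero) (+ A) (+ B) ⟩
      (+ a zero ℤ.+ + A) ℤ.- (+ b zero ℤ.+ + B)
        ≡⟨ sym (cong₂ ℤ._-_ (ℤP.pos-+ (a zero) A) (ℤP.pos-+ (b zero) B)) ⟩
      + (a zero + A) ℤ.- + (b zero + B) ∎
      where
      open ≡-Reasoning
      A = sum (a ∘ suc)
      B = sum (b ∘ suc)

  sum-mono : ∀ {n} {g h : Fin n → ℕ} → (∀ u → g u ≤ h u) → sum g ≤ sum h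
  sum-mono {zero}  g≤h = z≤n
  sum-mono {suc n} g≤h = ℕP.+-mono-≤ (g≤h zero) (sum-mono (g≤h ∘ suc))

  sum-ones : ∀ n → sum {n} (λ _ → 1) ≡ n
  sum-ones zero    = refl
  sum-ones (suc n) = cong suc (sum-ones n)

  am-gm : ∀ x y → x * y + x * y ≤ x * x + y * y
  am-gm x y with ℕP.≤-total x y
  ... | inj₁ x≤y with ℕP.m≤n⇒∃[o]m+o≡n x≤y
  ...   | d , refl = ℕP.≤-trans (ℕP.m≤m+n _ (d * d))
          (ℕP.≤-reflexive (solve 2 (λ x d → x :* (x :+ d) :+ x :* (x :+ d) :+ d :* d
                                          := x :* x :+ (x :+ d) :* (x :+ d)) refl x d))
    where open NatSolver
  am-gm x y | inj₂ y≤x with ℕP.m≤n⇒∃[o]m+o≡n y≤x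
  ...   | d , refl = ℕP.≤-trans (ℕP.m≤m+n _ (d * d))
          (ℕP.≤-reflexive (solve 2 (λ y d → (y :+ d) :* y :+ (y :+ d) :* y :+ d :* d
                                          := (y :+ d) :* (y :+ d) :+ y :* y) refl y d))
    where open NatSolver

  -- Completing the square: the difference of the two sides is (t - (k+1)q)².
  square-gap : ∀ k t q → suc (suc k) * (k * (t * t)) + suc (suc k) * (suc k * (q * t + q * t))
                         ≤ suc k * (suc k * ((t + q) * (t + q)))
  square-gap k t q = ℕP.+-cancelʳ-≤ (x * t + x * t) _ _ (begin
    L + (x * t + x * t) ≤⟨ ℕP.+-monoʳ-≤ L (am-gm x t) ⟩
    L + (x * x + t * t) ≡⟨ solve 3 (λ k t q →
        let L = (con 2 :+ k) :* (k :* (t :* t)) :+ (con 2 :+ k) :* ((con 1 :+ k) :* (q :* t :+ q :* t))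
            x = (con 1 :+ k) :* q
        in L :+ (x :* x :+ t :* t)
           := (con 1 :+ k) :* ((con 1 :+ k) :* ((t :+ q) :* (t :+ q))) :+ (x :* t :+ x :* t)) refl k t q ⟩
    suc k * (suc k * ((t + q) * (t + q))) + (x * t + x * t) ∎)
    where
    open ℕP.≤-Reasoning
    open NatSolver
    x = suc k * q
    L = suc (suc k) * (k * (t * t)) + suc (suc k) * (suc k * (q * t + q * t))

  turan-step : ∀ k e e′ t q → suc k * e′ ≤ k * (t * t) → e ≤ e′ + (q * t + q * t) →
               suc (suc k) * e ≤ suc k * ((t + q) * (t + q))
  turan-step k e e′ t q ih e≤ = ℕP.*-cancelˡ-≤ (suc k) (begin
    suc k * (suc (suc k) * e)
      ≡⟨ x∙yz≈y∙xz (suc k) (suc (suc k)) e ⟩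
    suc (suc k) * (suc k * e)
      ≤⟨ ℕP.*-monoʳ-≤ (suc (suc k)) (ℕP.*-monoʳ-≤ (suc k) e≤) ⟩
    suc (suc k) * (suc k * (e′ + (q * t + q * t)))
      ≡⟨ cong (suc (suc k) *_) (ℕP.*-distribˡ-+ (suc k) e′ _) ⟩
    suc (suc k) * (suc k * e′ + suc k * (q * t + q * t))
      ≡⟨ ℕP.*-distribˡ-+ (suc (suc k)) (suc k * e′) (suc k * (q * t + q * t)) ⟩
    suc (suc k) * (suc k * e′) + suc (suc k) * (suc k * (q * t + q * t))
      ≤⟨ ℕP.+-monoˡ-≤ _ (ℕP.*-monoʳ-≤ (suc (suc k)) ih) ⟩
    suc (suc k) * (k * (t * t)) + suc (suc k) * (suc k * (q * t + q * t))
      ≤⟨ square-gap k t q ⟩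
    suc k * (suc k * ((t + q) * (t + q))) ∎)
    where open ℕP.≤-Reasoning

  ceilHalfSucc-≤ : ∀ δ x → suc δ ≤ x + x → ceilHalfSucc δ ≤ x
  ceilHalfSucc-≤ δ x δ<2x = ℕP.≤-pred (m<n*o⇒m/o<n (begin-strict
    δ + 2          ≡⟨ ℕP.+-comm δ 2 ⟩
    suc (suc δ)    <⟨ s≤s (s≤s δ<2x) ⟩
    suc (suc (x + x)) ≡⟨ solve 1 (λ x → con 2 :+ (x :+ x) := (con 1 :+ x) :* con 2) refl x ⟩
    suc x * 2      ∎))
    where
    open ℕP.≤-Reasoning
    open NatSolver

  ceilHalfSucc-suc : ∀ δ → ceilHalfSucc δ ≡ suc (ceilHalfSucc δ ∸ 1)
  ceilHalfSucc-suc δ = sym (ℕP.m+[n∸m]≡n (m≥n⇒m/n>0 {δ + 2} {2} (ℕP.m≤n+m 2 δ)))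

  difference-positive : ∀ a b → ℤ.1ℤ ℤ.≤ + a ℤ.- + b → suc b ≤ a
  difference-positive a b 1≤a-b = ℤP.drop‿+≤+ (begin
    + suc b                    ≡⟨ ℤP.pos-+ 1 b ⟩
    ℤ.1ℤ ℤ.+ + b               ≤⟨ ℤP.+-monoˡ-≤ (+ b) 1≤a-b ⟩
    (+ a ℤ.- + b) ℤ.+ + b      ≡⟨ solve 2 (λ a b → (a :- b) :+ b := a) refl (+ a) (+ b) ⟩
    + a                        ∎)
    where
    open ℤP.≤-Reasoning
    open IntSolver

  ⟦_⟧ : Bool → ℕ
  ⟦ b ⟧ = if b then 1 else 0

  ⟦∧⟧ : ∀ x y → ⟦ x ∧ y ⟧ ≡ ⟦ x ⟧ * ⟦ y ⟧
  ⟦∧⟧ false y = refl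
  ⟦∧⟧ true  y = sym (ℕP.+-identityʳ ⟦ y ⟧)

  ∧-true-left : ∀ {x y} → x ∧ y ≡ true → x ≡ true
  ∧-true-left {true} _ = refl

  ∧-true-right : ∀ {x y} → x ∧ y ≡ true → y ≡ true
  ∧-true-right {true} y≡true = y≡true

  module VertexSets {n : ℕ} (G : SimpleGraph n) where

    VSet : Set
    VSet = Fin n → Bool

    𝟙 : VSet → Fin n → ℕ
    𝟙 S u = ⟦ S u ⟧

    size : VSet → ℕ
    size S = sum (𝟙 S)

    ∑∈ : VSet → (Fin n → ℕ) → ℕ
    ∑∈ S g = sum (λ u → ⟦ S u ⟧ * g u)

    nbhdIn : VSet → Fin n → VSet
    nbhdIn S v u = S u ∧ adj G v u

    nbrs : VSet → Fin n → ℕ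
    nbrs S v = size (nbhdIn S v)

    -- The number of ordered pairs (u , w) of adjacent vertices with u ∈ S and w ∈ T.
    edges : VSet → VSet → ℕ
    edges S T = ∑∈ S (nbrs T)

    ∑∈-mono : ∀ S {g h : Fin n → ℕ} → (∀ u → S u ≡ true → g u ≤ h u) → ∑∈ S g ≤ ∑∈ S h
    ∑∈-mono S {g} {h} g≤h = sum-mono termwise
      where
      termwise : ∀ u → ⟦ S u ⟧ * g u ≤ ⟦ S u ⟧ * h u
      termwise u with S u in Su
      ... | false = z≤n
      ... | true  = ℕP.+-monoˡ-≤ 0 (g≤h u Su)

    ∑∈-const : ∀ S k → ∑∈ S (λ _ → k) ≡ size S * k
    ∑∈-const S k = sym (*-distribʳ-sum k (𝟙 S))

    ∑∈-+ : ∀ S (g h : Fin n → ℕ) → ∑∈ S (λ u → g u + h u) ≡ ∑∈ S g + ∑∈ S h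
    ∑∈-+ S g h = trans (sum-cong-≗ (λ u → ℕP.*-distribˡ-+ ⟦ S u ⟧ (g u) (h u)))
      (∑-distrib-+ (λ u → ⟦ S u ⟧ * g u) (λ u → ⟦ S u ⟧ * h u))

    edges-sym : ∀ S T → edges S T ≡ edges T S
    edges-sym S T = begin
      sum (λ u → ⟦ S u ⟧ * nbrs T u)
        ≡⟨ sum-cong-≗ (λ u → *-distribˡ-sum ⟦ S u ⟧ (𝟙 (nbhdIn T u))) ⟩
      sum (λ u → sum (λ w → ⟦ S u ⟧ * ⟦ T w ∧ adj G u w ⟧))
        ≡⟨ sum-cong-≗ (λ u → sum-cong-≗ (pair-sym u)) ⟩
      sum (λ u → sum (λ w → ⟦ T w ⟧ * ⟦ S u ∧ adj G w u ⟧))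
        ≡⟨ ∑-comm (λ u w → ⟦ T w ⟧ * ⟦ S u ∧ adj G w u ⟧) ⟩
      sum (λ w → sum (λ u → ⟦ T w ⟧ * ⟦ S u ∧ adj G w u ⟧))
        ≡⟨ sum-cong-≗ (λ w → *-distribˡ-sum ⟦ T w ⟧ (𝟙 (nbhdIn S w))) ⟨
      sum (λ w → ⟦ T w ⟧ * nbrs S w) ∎
      where
      open ≡-Reasoning
      pair-sym : ∀ u w → ⟦ S u ⟧ * ⟦ T w ∧ adj G u w ⟧ ≡ ⟦ T w ⟧ * ⟦ S u ∧ adj G w u ⟧
      pair-sym u w rewrite ⟦∧⟧ (T w) (adj G u w) | ⟦∧⟧ (S u) (adj G w u) | SimpleGraph.sym G u w =
        x∙yz≈y∙xz ⟦ S u ⟧ ⟦ T w ⟧ ⟦ adj G w u ⟧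

    module Split {S T U : VSet} (S≡T⊎U : ∀ u → ⟦ S u ⟧ ≡ ⟦ T u ⟧ + ⟦ U u ⟧) where

      size-split : size S ≡ size T + size U
      size-split = trans (sum-cong-≗ S≡T⊎U) (∑-distrib-+ (𝟙 T) (𝟙 U))

      nbrs-split : ∀ v → nbrs S v ≡ nbrs T v + nbrs U v
      nbrs-split v = trans (sum-cong-≗ term) (∑-distrib-+ (𝟙 (nbhdIn T v)) (𝟙 (nbhdIn U v)))
        where
        term : ∀ u → ⟦ S u ∧ adj G v u ⟧ ≡ ⟦ T u ∧ adj G v u ⟧ + ⟦ U u ∧ adj G v u ⟧
        term u rewrite ⟦∧⟧ (S u) (adj G v u) | ⟦∧⟧ (T u) (adj G v u) | ⟦∧⟧ (U u) (adj G v u) | S≡T⊎U u =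
          ℕP.*-distribʳ-+ ⟦ adj G v u ⟧ ⟦ T u ⟧ ⟦ U u ⟧

      ∑∈-split : ∀ g → ∑∈ S g ≡ ∑∈ T g + ∑∈ U g
      ∑∈-split g = trans (sum-cong-≗ term) (∑-distrib-+ (λ u → ⟦ T u ⟧ * g u) (λ u → ⟦ U u ⟧ * g u))
        where
        term : ∀ u → ⟦ S u ⟧ * g u ≡ ⟦ T u ⟧ * g u + ⟦ U u ⟧ * g u
        term u rewrite S≡T⊎U u = ℕP.*-distribʳ-+ (g u) ⟦ T u ⟧ ⟦ U u ⟧

      edges-splitʳ : ∀ R → edges R S ≡ edges R T + edges R U
      edges-splitʳ R = trans (sum-cong-≗ (λ u → cong (⟦ R u ⟧ *_) (nbrs-split u))) (∑∈-+ R _ _)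

      -- Pairs inside S either lie inside T or have an end in U (counted at most twice).
      edges-within : edges S S ≤ edges T T + (edges U S + edges U S)
      edges-within = begin
        edges S S                             ≡⟨ ∑∈-split (nbrs S) ⟩
        edges T S + edges U S                 ≡⟨ cong (_+ edges U S) (edges-splitʳ T) ⟩
        edges T T + edges T U + edges U S     ≤⟨ ℕP.+-monoˡ-≤ (edges U S) (ℕP.+-monoʳ-≤ (edges T T) TU≤US) ⟩
        edges T T + edges U S + edges U S     ≡⟨ ℕP.+-assoc (edges T T) _ _ ⟩
        edges T T + (edges U S + edges U S)   ∎
        where
        open ℕP.≤-Reasoning
        TU≤US : edges T U ≤ edges U S
        TU≤US = ℕP.≤-trans (ℕP.≤-reflexive (edges-sym T U))
          (∑∈-mono U (λ u _ → ℕP.≤-trans (ℕP.m≤m+n (nbrs T u) (nbrs U u)) (ℕP.≤-reflexive (sym (nbrs-split u)))))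

    Clique : VSet → ℕ → Set
    Clique S k = Σ (Fin k → Fin n) λ φ → Injective _≡_ _≡_ φ × (∀ i → S (φ i) ≡ true)
                   × (∀ i j → i ≢ j → adj G (φ i) (φ j) ≡ true)

    adjacent-distinct : ∀ {u w} → adj G u w ≡ true → u ≢ w
    adjacent-distinct {u} uw refl with trans (sym uw) (SimpleGraph.irrefl G u)
    ... | ()

    singleton-clique : ∀ {S w} → S w ≡ true → Clique S 1
    singleton-clique {w = w} Sw =
      (λ _ → w) , (λ { {zero} {zero} _ → refl }) , (λ _ → Sw) , λ { zero zero 0≢0 → ⊥-elim (0≢0 refl) }

    clique-extend : ∀ {k} S v → S v ≡ true → Clique (nbhdIn S v) k → Clique S (suc k)
    clique-extend S v Sv (φ , φ-inj , φ∈ , φ-adj) = v ∷ φ , inj , ∈S , adjacent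
      where
      v~φ : ∀ i → adj G v (φ i) ≡ true
      v~φ i = ∧-true-right (φ∈ i)
      inj : Injective _≡_ _≡_ (v ∷ φ)
      inj {zero}  {zero}  _   = refl
      inj {zero}  {suc j} v≡φ = ⊥-elim (adjacent-distinct (v~φ j) v≡φ)
      inj {suc i} {zero}  φ≡v = ⊥-elim (adjacent-distinct (v~φ i) (sym φ≡v))
      inj {suc i} {suc j} φ≡φ = cong suc (φ-inj φ≡φ)
      ∈S : ∀ i → S ((v ∷ φ) i) ≡ true
      ∈S zero    = Sv
      ∈S (suc i) = ∧-true-left (φ∈ i)
      adjacent : ∀ i j → i ≢ j → adj G ((v ∷ φ) i) ((v ∷ φ) j) ≡ true
      adjacent zero    zero    0≢0 = ⊥-elim (0≢0 refl)
      adjacent zero    (suc j) _   = v~φ j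
      adjacent (suc i) zero    _   = trans (SimpleGraph.sym G (φ i) v) (v~φ i)
      adjacent (suc i) (suc j) i≢j = φ-adj i j (i≢j ∘ cong suc)

    edgeless : ∀ S → ¬ Clique S 2 → edges S S ≡ 0
    edgeless S no-edge = trans (sum-cong-≗ term) (sum-replicate-zero n)
      where
      term : ∀ u → ⟦ S u ⟧ * nbrs S u ≡ 0
      term u with S u in Su
      ... | false = refl
      ... | true  = trans (ℕP.+-identityʳ _) (trans (sum-cong-≗ no-neighbour) (sum-replicate-zero n))
        where
        no-neighbour : ∀ w → ⟦ nbhdIn S u w ⟧ ≡ 0
        no-neighbour w with nbhdIn S u w in Suw
        ... | false = refl
        ... | true  = ⊥-elim (no-edge (clique-extend S u Su (singleton-clique {nbhdIn S u} Suw)))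

    nonNbhdIn : VSet → Fin n → VSet
    nonNbhdIn S v u = S u ∧ not (adj G v u)

    nbhd-split : ∀ S v u → ⟦ S u ⟧ ≡ ⟦ nbhdIn S v u ⟧ + ⟦ nonNbhdIn S v u ⟧
    nbhd-split S v u with S u | adj G v u
    ... | false | _     = refl
    ... | true  | false = refl
    ... | true  | true  = refl

    maximiser : Fin n → (h : Fin n → ℕ) → ∃ λ v → ∀ u → h u ≤ h v
    maximiser v₀ h = argmax h v₀ (allFin n) , λ u → All.lookup (f[xs]≤f[argmax] v₀ (allFin n)) (∈-allFin u)

    -- Induction on k: split S at a vertex v of maximum
    -- degree into its neighbourhood T (which has no clique of size k + 1) and the rest U.
    -- The vertex v₀ only witnesses that the graph is nonempty.
    turan : Fin n → ∀ k S → ¬ Clique S (2 + k) → suc k * edges S S ≤ k * (size S * size S)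
    turan v₀ zero    S no-edge = ℕP.≤-reflexive (trans (ℕP.+-identityʳ _) (edgeless S no-edge))
    turan v₀ (suc k) S no-clique with maximiser v₀ (λ u → ⟦ S u ⟧ * nbrs S u)
    ... | v , maximal with S v in Sv
    ...   | false = ℕP.≤-trans (ℕP.≤-reflexive (trans (cong (suc (suc k) *_) no-pairs) (ℕP.*-zeroʳ (suc (suc k)))))
                      z≤n
      where
      -- the maximiser lies outside S, so every term ⟦ S u ⟧ * nbrs S u vanishes
      no-pairs : edges S S ≡ 0
      no-pairs = ℕP.n≤0⇒n≡0 (ℕP.≤-trans (sum-mono maximal) (ℕP.≤-reflexive (sum-replicate-zero n)))
    ...   | true  = subst (λ s → suc (suc k) * edges S S ≤ suc k * (s * s)) (sym size-split)
                      (turan-step k _ _ (size T) (size U) ih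
                        (ℕP.≤-trans edges-within (ℕP.+-monoʳ-≤ (edges T T) (ℕP.+-mono-≤ U-bound U-bound))))
      where
      T U : VSet
      T = nbhdIn S v
      U = nonNbhdIn S v
      open Split {S} {T} {U} (nbhd-split S v)
      ih : suc k * edges T T ≤ k * (size T * size T)
      ih = turan v₀ k T (no-clique ∘ clique-extend S v Sv)
      -- every vertex of S has at most nbrs S v = size T neighbours in S
      U-bound : edges U S ≤ size U * size T
      U-bound = ℕP.≤-trans (∑∈-mono U dominated) (ℕP.≤-reflexive (∑∈-const U (size T)))
        where
        dominated : ∀ u → U u ≡ true → nbrs S u ≤ size T
        dominated u Uu = begin
          nbrs S u                  ≡⟨ ℕP.+-identityʳ (nbrs S u) ⟨
          1 * nbrs S u              ≡⟨ cong (λ b → ⟦ b ⟧ * nbrs S u) (∧-true-left {S u} Uu) ⟨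
          ⟦ S u ⟧ * nbrs S u        ≤⟨ maximal u ⟩
          1 * nbrs S v              ≡⟨ ℕP.+-identityʳ (nbrs S v) ⟩
          size T                    ∎
          where open ℕP.≤-Reasoning

  isPlus : ∀ {x : ℤ} → x ≡ ℤ.1ℤ ⊎ x ≡ ℤ.-1ℤ → Bool
  isPlus (inj₁ _) = true
  isPlus (inj₂ _) = false

  signed-value : ∀ {x} (h : x ≡ ℤ.1ℤ ⊎ x ≡ ℤ.-1ℤ) → x ≡ + ⟦ isPlus h ⟧ ℤ.- + ⟦ not (isPlus h) ⟧
  signed-value (inj₁ refl) = refl
  signed-value (inj₂ refl) = refl

  signed-masked : ∀ {x} (h : x ≡ ℤ.1ℤ ⊎ x ≡ ℤ.-1ℤ) b →
    (if b then x else + 0) ≡ + ⟦ isPlus h ∧ b ⟧ ℤ.- + ⟦ not (isPlus h) ∧ b ⟧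
  signed-masked (inj₁ refl) false = refl
  signed-masked (inj₁ refl) true  = refl
  signed-masked (inj₂ refl) false = refl
  signed-masked (inj₂ refl) true  = refl

  module SignedTotalDomination {n} (G : SimpleGraph n) (f : Fin n → ℤ) (stdf : IsSTDF G f) where
    open VertexSets G

    P M : VSet
    P u = isPlus (proj₁ stdf u)
    M u = not (P u)

    V≡P⊎M : ∀ u → ⟦ true ⟧ ≡ ⟦ P u ⟧ + ⟦ M u ⟧
    V≡P⊎M u with P u
    ... | false = refl
    ... | true  = refl

    open Split {λ _ → true} {P} {M} V≡P⊎M

    size-P+M : size P + size M ≡ n
    size-P+M = trans (sym size-split) (sum-ones n)

    weight-split : weight f ≡ + size P ℤ.- + size M
    weight-split = sumℤ-difference f (𝟙 P) (𝟙 M) (λ u → signed-value (proj₁ stdf u))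

    nbhdSum-split : ∀ v → nbhdSum G f v ≡ + nbrs P v ℤ.- + nbrs M v
    nbhdSum-split v = sumℤ-difference _ (𝟙 (nbhdIn P v)) (𝟙 (nbhdIn M v))
                        (λ u → signed-masked (proj₁ stdf u) (adj G v u))

    degree-split : ∀ v → degree G v ≡ nbrs P v + nbrs M v
    degree-split v = trans (sumℕ≡sum (λ u → ⟦ adj G v u ⟧)) (nbrs-split v)

    M<P : ∀ v → suc (nbrs M v) ≤ nbrs P v
    M<P v = difference-positive _ _ (subst (ℤ.1ℤ ℤ.≤_) (nbhdSum-split v) (proj₂ stdf v))

    ceilHalfSucc-≤-P : ∀ δ → (∀ v → δ ≤ degree G v) → ∀ v → ceilHalfSucc δ ≤ nbrs P v
    ceilHalfSucc-≤-P δ δ≤deg v = ceilHalfSucc-≤ δ (nbrs P v) (begin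
      suc δ                           ≤⟨ s≤s (δ≤deg v) ⟩
      suc (degree G v)                ≡⟨ cong suc (degree-split v) ⟩
      suc (nbrs P v + nbrs M v)       ≡⟨ ℕP.+-suc (nbrs P v) (nbrs M v) ⟨
      nbrs P v + suc (nbrs M v)       ≤⟨ ℕP.+-monoʳ-≤ (nbrs P v) (M<P v) ⟩
      nbrs P v + nbrs P v             ∎)
      where open ℕP.≤-Reasoning

    pair-count : ∀ δ → (∀ v → δ ≤ degree G v) → size M * ceilHalfSucc δ + size P ≤ edges P P
    pair-count δ δ≤deg = begin
      size M * c + size P               ≡⟨ cong (_+ size P) (∑∈-const M c) ⟨
      ∑∈ M (λ _ → c) + size P           ≤⟨ ℕP.+-monoˡ-≤ (size P) (∑∈-mono M (λ u _ → ceilHalfSucc-≤-P δ δ≤deg u)) ⟩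
      edges M P + size P                ≡⟨ cong (_+ size P) (edges-sym M P) ⟩
      edges P M + size P                ≡⟨ cong (λ k → edges P M + k) (trans (∑∈-const P 1) (ℕP.*-identityʳ (size P))) ⟨
      edges P M + ∑∈ P (λ _ → 1)        ≡⟨ ∑∈-+ P (nbrs M) (λ _ → 1) ⟨
      ∑∈ P (λ u → nbrs M u + 1)         ≤⟨ ∑∈-mono P (λ u _ → ℕP.≤-trans (ℕP.≤-reflexive (ℕP.+-comm (nbrs M u) 1)) (M<P u)) ⟩
      edges P P                         ∎
      where
      open ℕP.≤-Reasoning
      c = ceilHalfSucc δ

    P-clique-free : ∀ k → ¬ ContainsComplete G k → ¬ Clique P k
    P-clique-free k no-Kk (φ , φ-inj , _ , φ-adj) = no-Kk (φ , φ-inj , φ-adj)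

module RationalArithmetic where
  open import Data.Rational using (mkℚ; 1ℚ; _+_; _*_; _-_; -_; _≤_; _<_)
  import Data.Rational.Properties as ℚP
  import Data.Rational.Unnormalised as ℚᵘ
  import Data.Rational.Unnormalised.Properties as ℚᵘP
  import Data.Nat.Coprimality as Coprime
  open import Data.Rational.Solver using () renaming (module +-*-Solver to RatSolver)
  open import Relation.Nullary using (yes; no; contradiction)

  toℚ : ℤ → ℚ
  toℚ z = mkℚ z 0 (Coprime.sym (Coprime.1-coprimeTo _))

  frac-one : ∀ z → frac z 1 (s≤s z≤n) ≡ toℚ z
  frac-one z = ℚP.↥p/↧p≡p (toℚ z)

  toℚ-+ : ∀ a b → toℚ (a ℤ.+ b) ≡ toℚ a + toℚ b
  toℚ-+ a b = sym (trans (cong (ℚ._/ 1) (cong₂ ℤ._+_ (ℤP.*-identityʳ a) (ℤP.*-identityʳ b)))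
                         (ℚP.↥p/↧p≡p (toℚ (a ℤ.+ b))))

  toℚ-* : ∀ a b → toℚ (a ℤ.* b) ≡ toℚ a * toℚ b
  toℚ-* a b = sym (ℚP.↥p/↧p≡p (toℚ (a ℤ.* b)))

  toℚ-neg : ∀ a → toℚ (ℤ.- a) ≡ - toℚ a
  toℚ-neg a = sym (ℚP.toℚᵘ-injective (ℚP.toℚᵘ-homo‿- (toℚ a)))

  toℚ-mono : ∀ {a b} → a ℤ.≤ b → toℚ a ≤ toℚ b
  toℚ-mono {a} {b} a≤b = ℚ.*≤* (subst₂ ℤ._≤_ (sym (ℤP.*-identityʳ a)) (sym (ℤP.*-identityʳ b)) a≤b)

  ofℕ-+ : ∀ a b → ofℕ (a ℕ.+ b) ≡ ofℕ a + ofℕ b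
  ofℕ-+ a b = trans (frac-one (+ (a ℕ.+ b)))
              (trans (cong toℚ (ℤP.pos-+ a b))
              (trans (toℚ-+ (+ a) (+ b)) (sym (cong₂ _+_ (frac-one (+ a)) (frac-one (+ b))))))

  ofℕ-* : ∀ a b → ofℕ (a ℕ.* b) ≡ ofℕ a * ofℕ b
  ofℕ-* a b = trans (frac-one (+ (a ℕ.* b)))
              (trans (cong toℚ (ℤP.pos-* a b))
              (trans (toℚ-* (+ a) (+ b)) (sym (cong₂ _*_ (frac-one (+ a)) (frac-one (+ b))))))

  ofℕ-suc : ∀ a → ofℕ (suc a) ≡ 1ℚ + ofℕ a
  ofℕ-suc = ofℕ-+ 1

  ofℕ-mono : ∀ {a b} → a ℕ.≤ b → ofℕ a ≤ ofℕ b
  ofℕ-mono {a} {b} a≤b = subst₂ _≤_ (sym (frac-one (+ a))) (sym (frac-one (+ b))) (toℚ-mono (ℤ.+≤+ a≤b))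

  ofℕ-frac : ∀ k d → ofℕ (suc d) * frac (+ k) (suc d) (s≤s z≤n) ≡ ofℕ k
  ofℕ-frac k d = trans (cong (_* (+ k ℚ./ suc d)) (frac-one (+ suc d)))
    (trans (ℚP.toℚᵘ-injective (ℚᵘP.≃-trans (ℚP.toℚᵘ-homo-* (toℚ (+ suc d)) (+ k ℚ./ suc d))
             (ℚᵘP.≃-trans (ℚᵘP.*-congˡ {ℚᵘ.mkℚᵘ (+ suc d) 0} (ℚP.toℚᵘ-fromℚᵘ (ℚᵘ.mkℚᵘ (+ k) d)))
               (ℚᵘ.*≡* cross-multiplied))))
           (sym (frac-one (+ k))))
    where
    cross-multiplied : (+ suc d ℤ.* + k) ℤ.* + 1 ≡ + k ℤ.* + (suc d ℕ.+ 0)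
    cross-multiplied = trans (ℤP.*-identityʳ _) (trans (ℤP.*-comm (+ suc d) (+ k))
                         (cong (λ x → + k ℤ.* + x) (sym (ℕP.+-identityʳ (suc d)))))

  ≤-of-squares : ∀ {x y} → 0ℚ ≤ y → x * x ≤ y * y → x ≤ y
  ≤-of-squares {x} {y} 0≤y x²≤y² with x ℚP.≤? y
  ... | yes x≤y = x≤y
  ... | no  x≰y = contradiction (ℚP.<-≤-trans y²<x² x²≤y²) (ℚP.<-irrefl refl)
    where
    y<x : y < x
    y<x = ℚP.≰⇒> x≰y
    y²<x² : y * y < x * x
    y²<x² = ℚP.≤-<-trans (ℚP.*-monoˡ-≤-nonNeg y {{ℚ.nonNegative 0≤y}} (ℚP.<⇒≤ y<x))
                         (ℚP.*-monoˡ-<-pos x {{ℚ.positive (ℚP.≤-<-trans 0≤y y<x)}} y<x)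

  +-cancelʳ-≤ : ∀ {x y} z → x + z ≤ y + z → x ≤ y
  +-cancelʳ-≤ {x} {y} z x+z≤y+z = subst₂ _≤_ (cancel x) (cancel y) (ℚP.+-monoˡ-≤ (- z) x+z≤y+z)
    where
    open RatSolver
    cancel : ∀ w → w + z - z ≡ w
    cancel w = solve 2 (λ w z → w :+ z :- z := w) refl w z

  0≤-* : ∀ {x y} → 0ℚ ≤ x → 0ℚ ≤ y → 0ℚ ≤ x * y
  0≤-* {x} {y} 0≤x 0≤y =
    ℚP.nonNegative⁻¹ (x * y) {{ℚP.nonNeg*nonNeg⇒nonNeg x {{ℚ.nonNegative 0≤x}} y {{ℚ.nonNegative 0≤y}}}}

  -- With r = 1 + a and c = 1 + b, the counting inequality r·(m·c + p) ≤ a·p² bounds the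
  -- radicand scaled by r²: r²·b² + 4·a·r·c·(p + m) ≤ X² for X = 2a·p + r·b. Both sides
  -- differ by 4a·(a·p² - r·(m·c + p)).
  radicand-bound : ∀ (a b p m : ℚ) → 0ℚ ≤ a →
    (1ℚ + a) * (m * (1ℚ + b) + p) ≤ a * (p * p) →
    (1ℚ + a) * (1ℚ + a) * (b * b) + ofℕ 4 * a * (1ℚ + a) * (1ℚ + b) * (p + m)
      ≤ ((a + a) * p + (1ℚ + a) * b) * ((a + a) * p + (1ℚ + a) * b)
  radicand-bound a b p m 0≤a H = +-cancelʳ-≤ (ofℕ 4 * a * (r * (m * c + p))) (begin
    Y + ofℕ 4 * a * (r * (m * c + p))
      ≤⟨ ℚP.+-monoʳ-≤ Y (ℚP.*-monoˡ-≤-nonNeg (ofℕ 4 * a) {{ℚ.nonNegative 0≤4a}} H) ⟩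
    Y + ofℕ 4 * a * (a * (p * p))
      ≡⟨ solve 4 (λ a b p m →
           let r = con 1ℚ :+ a ; c = con 1ℚ :+ b ; four = con (ofℕ 4) in
           r :* r :* (b :* b) :+ four :* a :* r :* c :* (p :+ m) :+ four :* a :* (a :* (p :* p))
           := ((a :+ a) :* p :+ r :* b) :* ((a :+ a) :* p :+ r :* b) :+ four :* a :* (r :* (m :* c :+ p)))
           refl a b p m ⟩
    X * X + ofℕ 4 * a * (r * (m * c + p)) ∎)
    where
    open ℚP.≤-Reasoning
    open RatSolver
    r c X Y : ℚ
    r = 1ℚ + a
    c = 1ℚ + b
    X = (a + a) * p + r * b
    Y = r * r * (b * b) + ofℕ 4 * a * r * c * (p + m)
    0≤4a : 0ℚ ≤ ofℕ 4 * a
    0≤4a = 0≤-* (ℚP.nonNegative⁻¹ (ofℕ 4)) 0≤a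

  -- The algebraic core, with a = r - 1 > 0 and b = c - 1 ≥ 0, f = a / r and g = r / a.
  -- If r·(m·c + p) ≤ a·p² and s² ≤ b² + 4·f·c·(p + m), then r·s ≤ X = 2a·p + r·b,
  -- because (r·s)² ≤ X² by radicand-bound and X ≥ 0; dividing by a gives
  -- g·(s - b) ≤ 2p, i.e. g·(s - b) - (p + m) ≤ p - m.
  quadratic-bound : ∀ (a b f g p m s : ℚ) → 0ℚ < a → 0ℚ ≤ b → 0ℚ ≤ p →
    (1ℚ + a) * f ≡ a → a * g ≡ 1ℚ + a →
    (1ℚ + a) * (m * (1ℚ + b) + p) ≤ a * (p * p) →
    s * s ≤ b * b + ofℕ 4 * f * (1ℚ + b) * (p + m) →
    g * (- b + s) - (p + m) ≤ p - m
  quadratic-bound a b f g p m s 0<a 0≤b 0≤p rf≡a ag≡r H s²≤D =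
    ℚP.*-cancelˡ-≤-pos a {{ℚ.positive 0<a}} (begin
      a * (g * (- b + s) - (p + m))
        ≡⟨ solve 6 (λ a g b s p m → a :* (g :* (:- b :+ s) :- (p :+ m)) := (a :* g) :* (:- b :+ s) :- a :* (p :+ m)) refl a g b s p m ⟩
      (a * g) * (- b + s) - a * (p + m)
        ≡⟨ cong (λ t → t * (- b + s) - a * (p + m)) ag≡r ⟩
      r * (- b + s) - a * (p + m)
        ≡⟨ solve 5 (λ r b s a n → r :* (:- b :+ s) :- a :* n := r :* s :- (r :* b :+ a :* n)) refl r b s a (p + m) ⟩
      r * s - (r * b + a * (p + m))
        ≤⟨ ℚP.+-monoˡ-≤ (- (r * b + a * (p + m))) rs≤X ⟩
      X - (r * b + a * (p + m))
        ≡⟨ solve 5 (λ a b p m r → (a :+ a) :* p :+ r :* b :- (r :* b :+ a :* (p :+ m)) := a :* (p :- m)) refl a b p m r ⟩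
      a * (p - m) ∎)
    where
    open ℚP.≤-Reasoning
    open RatSolver
    r c X : ℚ
    r = 1ℚ + a
    c = 1ℚ + b
    X = (a + a) * p + r * b
    0≤a : 0ℚ ≤ a
    0≤a = ℚP.<⇒≤ 0<a
    0≤r : 0ℚ ≤ r
    0≤r = ℚP.+-mono-≤ (ℚP.nonNegative⁻¹ 1ℚ) 0≤a
    0≤X : 0ℚ ≤ X
    0≤X = ℚP.+-mono-≤ (0≤-* (ℚP.+-mono-≤ 0≤a 0≤a) 0≤p) (0≤-* 0≤r 0≤b)
    rs≤X : r * s ≤ X
    rs≤X = ≤-of-squares 0≤X (begin
      r * s * (r * s)
        ≡⟨ solve 2 (λ r s → r :* s :* (r :* s) := r :* r :* (s :* s)) refl r s ⟩
      r * r * (s * s)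
        ≤⟨ ℚP.*-monoˡ-≤-nonNeg (r * r) {{ℚ.nonNegative (0≤-* 0≤r 0≤r)}} s²≤D ⟩
      r * r * (b * b + ofℕ 4 * f * c * (p + m))
        ≡⟨ solve 7 (λ r b four f c p m → r :* r :* (b :* b :+ four :* f :* c :* (p :+ m)) := r :* r :* (b :* b) :+ four :* (r :* f) :* r :* c :* (p :+ m)) refl r b (ofℕ 4) f c p m ⟩
      r * r * (b * b) + ofℕ 4 * (r * f) * r * c * (p + m)
        ≡⟨ cong (λ t → r * r * (b * b) + ofℕ 4 * t * r * c * (p + m)) rf≡a ⟩
      r * r * (b * b) + ofℕ 4 * a * r * c * (p + m)
        ≤⟨ radicand-bound a b p m 0≤a H ⟩
      X * X ∎)

  -- The quadratic bound for natural-number data, in the shape of the theorem: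
  -- r = j + 2, c = C + 1, n = p + m and γ = p - m.
  rational-bound : ∀ j c C p m n (γ : ℤ) → c ≡ suc C → n ≡ p ℕ.+ m → γ ≡ + p ℤ.- + m →
    suc (suc j) ℕ.* (m ℕ.* c ℕ.+ p) ℕ.≤ suc j ℕ.* (p ℕ.* p) →
    (s : ℚ) →
    s * s ≤ ofℕ (C ℕ.* C) + ofℕ 4 * frac (+ suc j) (suc (suc j)) (s≤s z≤n) * ofℕ c * ofℕ n →
    frac (+ suc (suc j)) (suc j) (s≤s z≤n) * (- ofℕ C + s) - ofℕ n ≤ frac γ 1 (s≤s z≤n)
  rational-bound j .(suc C) C p m .(p ℕ.+ m) .(+ p ℤ.- + m) refl refl refl H s s²≤D =
    subst₂ (λ N Γ → g * (- b + s) - N ≤ Γ) (sym (ofℕ-+ p m)) (sym γ≡p-m)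
      (quadratic-bound a b f g p′ m′ s 0<a (0≤ofℕ C) (0≤ofℕ p) f-def g-def H′ s²≤D′)
    where
    a b p′ m′ f g : ℚ
    a  = ofℕ (suc j)
    b  = ofℕ C
    p′ = ofℕ p
    m′ = ofℕ m
    f  = frac (+ suc j) (suc (suc j)) (s≤s z≤n)
    g  = frac (+ suc (suc j)) (suc j) (s≤s z≤n)
    0≤ofℕ : ∀ k → 0ℚ ≤ ofℕ k
    0≤ofℕ k = ofℕ-mono {0} {k} z≤n
    0<a : 0ℚ < a
    0<a = subst (0ℚ <_) (sym (frac-one (+ suc j))) (ℚP.positive⁻¹ (toℚ (+ suc j)))
    r≡1+a : ofℕ (suc (suc j)) ≡ 1ℚ + a
    r≡1+a = ofℕ-suc (suc j)
    f-def : (1ℚ + a) * f ≡ a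
    f-def = trans (cong (_* f) (sym r≡1+a)) (ofℕ-frac (suc j) (suc j))
    g-def : a * g ≡ 1ℚ + a
    g-def = trans (ofℕ-frac (suc (suc j)) j) r≡1+a
    H′ : (1ℚ + a) * (m′ * (1ℚ + b) + p′) ≤ a * (p′ * p′)
    H′ = subst₂ _≤_
      (trans (ofℕ-* (suc (suc j)) (m ℕ.* suc C ℕ.+ p)) (cong₂ _*_ r≡1+a
        (trans (ofℕ-+ (m ℕ.* suc C) p) (cong (_+ p′) (trans (ofℕ-* m (suc C)) (cong (m′ *_) (ofℕ-suc C)))))))
      (trans (ofℕ-* (suc j) (p ℕ.* p)) (cong (a *_) (ofℕ-* p p)))
      (ofℕ-mono H)
    s²≤D′ : s * s ≤ b * b + ofℕ 4 * f * (1ℚ + b) * (p′ + m′)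
    s²≤D′ = subst (s * s ≤_)
      (cong₂ _+_ (ofℕ-* C C) (cong₂ (λ y z → ofℕ 4 * f * y * z) (ofℕ-suc C) (ofℕ-+ p m))) s²≤D
    γ≡p-m : frac (+ p ℤ.- + m) 1 (s≤s z≤n) ≡ p′ - m′
    γ≡p-m = begin
      frac (+ p ℤ.- + m) 1 (s≤s z≤n)  ≡⟨ frac-one (+ p ℤ.- + m) ⟩
      toℚ (+ p ℤ.+ ℤ.- + m)           ≡⟨ toℚ-+ (+ p) (ℤ.- + m) ⟩
      toℚ (+ p) + toℚ (ℤ.- + m)       ≡⟨ cong (λ x → toℚ (+ p) + x) (toℚ-neg (+ m)) ⟩
      toℚ (+ p) - toℚ (+ m)           ≡⟨ cong₂ _-_ (frac-one (+ p)) (frac-one (+ m)) ⟨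
      p′ - m′                         ∎
      where open ≡-Reasoning

open Counting
open RationalArithmetic

theorem3p5 : (r : ℕ) (r≥2 : 2 ℕ.≤ r) (n : ℕ) (G : SimpleGraph n) →
    NoIsolatedVertices G → ¬ ContainsComplete G (ℕ.suc r) →
    (δ : ℕ) → IsMinDegree G δ → (γ : ℤ.ℤ) → IsSignedTotalDomNumber G γ →
    -- for every rational s ≥ 0 with s² ≤ (c-1)² + 4·((r-1)/r)·c·n, i.e. every s ≤ √(…)
    (s : ℚ) → 0ℚ ℚ.≤ s →
    s ℚ.* s ℚ.≤ ofℕ ((ceilHalfSucc δ ∸ 1) ℕ.* (ceilHalfSucc δ ∸ 1))
                ℚ.+ ofℕ 4 ℚ.* frac (+ (r ∸ 1)) r (≤-trans (ℕ.s≤s ℕ.z≤n) r≥2)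
                    ℚ.* ofℕ (ceilHalfSucc δ) ℚ.* ofℕ n →
    frac (+ r) (r ∸ 1) (∸-monoˡ-≤ 1 r≥2)
      ℚ.* (ℚ.- ofℕ (ceilHalfSucc δ ∸ 1) ℚ.+ s) ℚ.- ofℕ n
      ℚ.≤ frac γ 1 (ℕ.s≤s ℕ.z≤n)
theorem3p5 (suc (suc j)) (s≤s (s≤s z≤n)) n G _ no-K δ ((v₀ , _) , δ≤deg) γ ((f , stdf , weight≡γ) , _) s _ s²≤D =
  rational-bound j c (c ∸ 1) p m n γ (ceilHalfSucc-suc δ) (sym size-P+M) (trans (sym weight≡γ) weight-split)
    counting-bound s s²≤D
  where
  open VertexSets G
  open SignedTotalDomination G f stdf
  c p m : ℕ
  c = ceilHalfSucc δ
  p = size P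
  m = size M
  -- r·(m·c + p) ≤ r·e(P,P) ≤ (r-1)·p², by double counting and Turán's theorem
  counting-bound : suc (suc j) ℕ.* (m ℕ.* c ℕ.+ p) ℕ.≤ suc j ℕ.* (p ℕ.* p)
  counting-bound = ℕP.≤-trans (ℕP.*-monoʳ-≤ (suc (suc j)) (pair-count δ δ≤deg))
                              (turan v₀ (suc j) P (P-clique-free (suc (suc (suc j))) no-K))
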